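{- Let $T$ be a tournament on $n$ vertices. Then $T$ is in-quadrangular if and only if for all distinct $u,v\in V(T)$, $|O[u]\cup O[v]|\neq n-1$.
   Context: A tournament $T$ is a loopless digraph in which for each pair of distinct vertices exactly one of $(u,v)$, $(v,u)$ is an arc; $u\rightarrow v$ means $(u,v)$ is an arc. $O(v)=\{u:v\rightarrow u\}$, $I(v)=\{u:u\rightarrow v\}$, and the closed outset is $O[v]=O(v)\cup\{v\}$. A digraph is in-quadrangular if $|I(u)\cap I(v)|\neq 1$ for all distinct vertices $u,v$. -}

module Defs where

open import Data.Nat using (ℕ; zero; suc; _+_)
open import Data.Fin using (Fin; zero; suc)
open import Data.Bool using (Bool; true; false; _∧_; _∨_; not)
open import Data.Product using (_×_)
open import Data.Sum using (_⊎_)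
open import Relation.Binary.PropositionalEquality using (_≡_; _≢_)
open import Relation.Nullary using (¬_)
open import Data.Fin using (_≟_)
open import Relation.Nullary.Decidable using (⌊_⌋)

-- A digraph on vertex set Fin n, given by its (Boolean) arc relation:
-- arc u v ≡ true  means  u → v.
Digraph : ℕ → Set
Digraph n = Fin n → Fin n → Bool

bool→ℕ : Bool → ℕ
bool→ℕ true  = 1
bool→ℕ false = 0

count : ∀ {n} → (Fin n → Bool) → ℕ
count {zero}  P = 0
count {suc n} P = bool→ℕ (P zero) + count (λ i → P (suc i))

IsTournament : ∀ {n} → Digraph n → Set
IsTournament {n} T =
  (∀ (u : Fin n) → T u u ≡ false) ×
  (∀ (u v : Fin n) → u ≢ v → ((T u v ≡ true) × (T v u ≡ false)) ⊎ ((T u v ≡ false) × (T v u ≡ true)))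

closedOut : ∀ {n} → Digraph n → Fin n → Fin n → Bool
closedOut T v w = T v w ∨ ⌊ w ≟ v ⌋

commonIn : ∀ {n} → Digraph n → Fin n → Fin n → Fin n → Bool
commonIn T u v w = T w u ∧ T w v

InQuadrangular : ∀ {n} → Digraph n → Set
InQuadrangular {n} T = ∀ (u v : Fin n) → u ≢ v → count (commonIn T u v) ≢ 1

{-# OPTIONS --safe #-}
module Submission where

-- In a tournament, a vertex w lies outside O[u] ∪ O[v] (u ≠ v) exactly when
-- w ∉ {u, v} and both arcs between w and u, v point out of w, i.e. when
-- w ∈ I(u) ∩ I(v). So the two sets are complementary and their sizes add up
-- to n, whence |I(u) ∩ I(v)| = 1 iff |O[u] ∪ O[v]| = n - 1.

open import Defs
open import Data.Nat using (ℕ; zero; suc; _+_; _∸_)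
open import Data.Nat.Properties using (+-cancelʳ-≡; suc-injective; +-commutativeSemigroup)
open import Algebra.Properties.CommutativeSemigroup +-commutativeSemigroup
  using () renaming (interchange to +-interchange)
open import Data.Fin using (Fin; zero; suc; _≟_)
open import Data.Bool using (Bool; true; false; _∨_; not)
open import Data.Bool.Properties using (∨-identityʳ; ∨-zeroʳ; ∧-zeroʳ)
open import Data.Product using (_,_; proj₁; proj₂)
open import Data.Sum using (inj₁; inj₂)
open import Relation.Binary.PropositionalEquality
open import Relation.Nullary using (yes; no)
open import Function.Bundles using (_⇔_; mk⇔; Equivalence)

count-cong : ∀ {n} {P Q : Fin n → Bool} → (∀ i → P i ≡ Q i) → count P ≡ count Q
count-cong {zero}  P≗Q = refl
count-cong {suc n} P≗Q = cong₂ _+_ (cong bool→ℕ (P≗Q zero)) (count-cong (λ i → P≗Q (suc i)))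

bool→ℕ-+-not : ∀ b → bool→ℕ b + bool→ℕ (not b) ≡ 1
bool→ℕ-+-not true  = refl
bool→ℕ-+-not false = refl

count-+-count-not : ∀ {n} (P : Fin n → Bool) → count P + count (λ i → not (P i)) ≡ n
count-+-count-not {zero}  P = refl
count-+-count-not {suc n} P = begin
  (a + x) + (b + y) ≡⟨ +-interchange a x b y ⟩
  (a + b) + (x + y) ≡⟨ cong₂ _+_ (bool→ℕ-+-not (P zero)) (count-+-count-not (λ i → P (suc i))) ⟩
  suc n             ∎
  where
  open ≡-Reasoning
  a = bool→ℕ (P zero)
  b = bool→ℕ (not (P zero))
  x = count (λ i → P (suc i))
  y = count (λ i → not (P (suc i)))

+-≡-suc⇒≡1⇔≡ : ∀ {c d m} → c + d ≡ suc m → (c ≡ 1 ⇔ d ≡ m)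
+-≡-suc⇒≡1⇔≡ {c} {d} {m} c+d≡1+m = mk⇔ c≡1⇒d≡m d≡m⇒c≡1
  where
  c≡1⇒d≡m : c ≡ 1 → d ≡ m
  c≡1⇒d≡m refl = suc-injective c+d≡1+m
  d≡m⇒c≡1 : d ≡ m → c ≡ 1
  d≡m⇒c≡1 refl = +-cancelʳ-≡ d c 1 c+d≡1+m

module _ {n} {T : Digraph n} (tournament : IsTournament T) where

  private
    loopless : ∀ u → T u u ≡ false
    loopless = proj₁ tournament

  arc-≡-not-reverse : ∀ {u v} → u ≢ v → T u v ≡ not (T v u)
  arc-≡-not-reverse {u} {v} u≢v with proj₂ tournament u v u≢v
  ... | inj₁ (uv , vu) rewrite uv | vu = refl
  ... | inj₂ (uv , vu) rewrite uv | vu = refl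

  closedOut-∪-≡-not-commonIn : ∀ {u v} → u ≢ v → ∀ w →
    (closedOut T u w ∨ closedOut T v w) ≡ not (commonIn T u v w)
  closedOut-∪-≡-not-commonIn {u} {v} u≢v w with w ≟ u
  ... | yes refl rewrite loopless w = refl
  ... | no w≢u with w ≟ v
  ...   | yes refl rewrite loopless w | ∨-zeroʳ (T u w ∨ false) | ∧-zeroʳ (T w u) = refl
  ...   | no w≢v
    rewrite ∨-identityʳ (T u w) | ∨-identityʳ (T v w)
          | arc-≡-not-reverse (≢-sym w≢u) | arc-≡-not-reverse (≢-sym w≢v)
    with T w u | T w v
  ... | true  | true  = refl
  ... | true  | false = refl
  ... | false | true  = refl
  ... | false | false = refl

  count-commonIn-+-count-closedOut-∪ : ∀ {u v} → u ≢ v →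
    count (commonIn T u v) + count (λ w → closedOut T u w ∨ closedOut T v w) ≡ n
  count-commonIn-+-count-closedOut-∪ {u} {v} u≢v = begin
    count (commonIn T u v) + count (λ w → closedOut T u w ∨ closedOut T v w)
      ≡⟨ cong (count (commonIn T u v) +_) (count-cong (closedOut-∪-≡-not-commonIn u≢v)) ⟩
    count (commonIn T u v) + count (λ w → not (commonIn T u v w))
      ≡⟨ count-+-count-not (commonIn T u v) ⟩
    n ∎
    where open ≡-Reasoning

proposition14 : ∀ (n : ℕ) (T : Digraph n) → IsTournament T →
    InQuadrangular T ⇔
      (∀ (u v : Fin n) → u ≢ v → count (λ w → closedOut T u w ∨ closedOut T v w) ≢ n ∸ 1)
-- Splitting on n avoids the truncated 0 ∸ 1 = 0; with no vertices both sides are vacuous.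
proposition14 zero    T tournament = mk⇔ (λ _ ()) (λ _ ())
proposition14 (suc m) T tournament = mk⇔
  (λ inQuad u v u≢v ∪≡m → inQuad u v u≢v (Equivalence.from (sizes u≢v) ∪≡m))
  (λ ∪≢m u v u≢v ∩≡1 → ∪≢m u v u≢v (Equivalence.to (sizes u≢v) ∩≡1))
  where
  sizes : ∀ {u v} → u ≢ v →
    count (commonIn T u v) ≡ 1 ⇔ count (λ w → closedOut T u w ∨ closedOut T v w) ≡ m
  sizes u≢v = +-≡-suc⇒≡1⇔≡ (count-commonIn-+-count-closedOut-∪ tournament u≢v)
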